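{- Let $G$ and $H$ be good graphs. Then there is a vertex $x$ of $G\square H$ such that $\sum_{y\in V(G\square H)}2^{\mathrm{dist}(x,y)}=\gamma(G)\gamma(H)$, i.e., the simple distribution supported on $x$ requires $\gamma(G)\gamma(H)$ pebbles to cover pebble $G\square H$. In particular, $\gamma(G\square H)\ge\gamma(G)\gamma(H)$.
   Context: All graphs are finite and connected. A pebbling step removes two pebbles from a vertex and places one pebble on an adjacent vertex. The cover pebbling number $\gamma(G)$ is the minimum $N$ such that for every placement of $N$ pebbles on $G$ some sequence of pebbling steps leaves at least one pebble on every vertex. A simple distribution is one with all pebbles on a single vertex. A graph $G$ is good if $\gamma(G)=\sum_{w\in V(G)}2^{\mathrm{dist}(w,u)}$ for some vertex $u\in V(G)$. $G\square H$ is the Cartesian product: vertex set $V(G)\times V(H)$, with $(w,v)\sim(w',v')$ iff ($w=w'$ and $v\sim v'$) or ($v=v'$ and $w\sim w'$). -}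

module Defs where

open import Data.Nat using (ℕ; zero; suc; _+_; _*_; _∸_; _^_; _≤_; _<_)
open import Data.Fin using (Fin; zero; suc; _≟_; remQuot)
open import Data.Bool using (Bool; true; false; _∧_; _∨_; if_then_else_)
open import Data.Product using (Σ; ∃; ∃-syntax; _×_; _,_)
open import Relation.Nullary using (¬_; does)
open import Relation.Binary.PropositionalEquality using (_≡_)
open import Relation.Binary.Construct.Closure.ReflexiveTransitive using (Star)

record Graph : Set where
  constructor mkGraph
  field
    n   : ℕ
    adj : Fin n → Fin n → Bool
open Graph public

V : Graph → Set
V G = Fin (n G)

sumFin : ∀ {k} → (Fin k → ℕ) → ℕ
sumFin {zero}  f = 0
sumFin {suc k} f = f zero + sumFin (λ i → f (suc i))

anyFin : ∀ {k} → (Fin k → Bool) → Bool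
anyFin {zero}  f = false
anyFin {suc k} f = f zero ∨ anyFin (λ i → f (suc i))

reach : (G : Graph) → ℕ → V G → V G → Bool
reach G zero    u v = does (u ≟ v)
reach G (suc k) u v = reach G k u v ∨ anyFin (λ w → reach G k u w ∧ adj G w v)

record IsConnectedGraph (G : Graph) : Set where
  field
    symmetric  : ∀ u v → adj G u v ≡ adj G v u
    irreflexive : ∀ u → adj G u u ≡ false
    connected  : ∀ u v → ∃[ k ] reach G k u v ≡ true

-- Graph distance: least k with reach G k u v (searching k = 0 .. n);
-- for connected graphs the search always succeeds.
distAux : (G : Graph) → V G → V G → ℕ → ℕ → ℕ
distAux G u v zero    k = k
distAux G u v (suc f) k = if reach G k u v then k else distAux G u v f (suc k)

dist : (G : Graph) → V G → V G → ℕ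
dist G u v = distAux G u v (n G) 0

_□_ : Graph → Graph → Graph
G □ H = mkGraph (n G * n H) A
  where
  A : Fin (n G * n H) → Fin (n G * n H) → Bool
  A i j with remQuot (n H) i | remQuot (n H) j
  ... | (w , v) | (w' , v') = (does (w ≟ w') ∧ adj H v v') ∨ (does (v ≟ v') ∧ adj G w w')

Distribution : Graph → Set
Distribution G = V G → ℕ

size : (G : Graph) → Distribution G → ℕ
size G D = sumFin D

move : (G : Graph) → Distribution G → V G → V G → Distribution G
move G D u v w =
  if does (w ≟ u) then D w ∸ 2 else (if does (w ≟ v) then suc (D w) else D w)

data PebblingStep (G : Graph) : Distribution G → Distribution G → Set where
  step : ∀ {D} u v → adj G u v ≡ true → 2 ≤ D u → PebblingStep G D (move G D u v)

Covers : (G : Graph) → Distribution G → Set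
Covers G D = ∀ v → 1 ≤ D v

CoverSolvable : (G : Graph) → Distribution G → Set
CoverSolvable G D = ∃[ D' ] (Star (PebblingStep G) D D' × Covers G D')

IsCoverPebblingNumber : Graph → ℕ → Set
IsCoverPebblingNumber G N =
  (∀ (D : Distribution G) → size G D ≡ N → CoverSolvable G D) ×
  (∀ M → M < N → ∃[ D ] (size G D ≡ M × ¬ CoverSolvable G D))

Good : Graph → Set
Good G = ∃[ N ] (IsCoverPebblingNumber G N × ∃[ u ] N ≡ sumFin (λ w → 2 ^ dist G w u))

-- Distances in G □ H add up coordinatewise, so for roots u of G and v of H the sum
-- Σ_y 2^dist((u,v),y) factors as (Σ_a 2^dist(u,a)) · (Σ_b 2^dist(v,b)) = γ(G) γ(H).
-- For the lower bound, give a pebble on w the value 2^dist(x,w).  A pebbling step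
-- spends two pebbles of value 2^d to create one of value at most 2^(d+1), so the total
-- value never increases; a covering has value at least Σ_w 2^dist(x,w), while N pebbles
-- on x have value N.  That dist really is the length of a shortest walk rests on the
-- balls around a vertex growing strictly until they stabilise, hence within n steps.

module Submission where

open import Defs
open import Data.Nat using (ℕ; zero; suc; _+_; _*_; _∸_; _^_; _≤_; _<_; z≤n; s≤s; _≤′_; ≤′-refl; ≤′-step)
open import Data.Nat.Properties hiding (_≟_)
open import Data.Fin using (Fin; zero; suc; _≟_; remQuot; combine; _↑ˡ_; _↑ʳ_)
open import Data.Fin.Properties using (remQuot-combine; combine-remQuot; all?; ¬∀⟶∃¬)
open import Data.Bool using (Bool; true; false; _∧_; _∨_; if_then_else_)
open import Data.Bool.Properties using (∨-zeroʳ; ∧-conicalˡ; ∧-conicalʳ)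
import Data.Bool.Properties as Bool
open import Data.Product using (∃-syntax; _×_; _,_; proj₁; proj₂)
open import Data.Sum using (_⊎_; inj₁; inj₂)
open import Function using (_∘_)
open import Algebra.Properties.CommutativeSemigroup +-commutativeSemigroup
  using () renaming (interchange to +-interchange)
open import Relation.Nullary using (¬_; Dec; does; yes; no; _because_; contradiction)
open import Relation.Nullary.Decidable using (dec-true)
open import Relation.Nullary.Reflects using (invert)
open import Relation.Binary.PropositionalEquality
open import Relation.Binary.Definitions using (tri<; tri≈; tri>)
open import Relation.Binary.Construct.Closure.ReflexiveTransitive using (Star; ε; _◅_)

sumFin-cong : ∀ {k} {f g : Fin k → ℕ} → (∀ i → f i ≡ g i) → sumFin f ≡ sumFin g
sumFin-cong {zero}  f≗g = refl
sumFin-cong {suc k} f≗g = cong₂ _+_ (f≗g zero) (sumFin-cong (f≗g ∘ suc))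

sumFin-mono-≤ : ∀ {k} {f g : Fin k → ℕ} → (∀ i → f i ≤ g i) → sumFin f ≤ sumFin g
sumFin-mono-≤ {zero}  f≤g = z≤n
sumFin-mono-≤ {suc k} f≤g = +-mono-≤ (f≤g zero) (sumFin-mono-≤ (f≤g ∘ suc))

sumFin-mono-< : ∀ {k} {f g : Fin k → ℕ} → (∀ i → f i ≤ g i) → ∀ a → f a < g a → sumFin f < sumFin g
sumFin-mono-< {suc k} f≤g zero    fa<ga = +-mono-<-≤ fa<ga (sumFin-mono-≤ (f≤g ∘ suc))
sumFin-mono-< {suc k} f≤g (suc a) fa<ga = +-mono-≤-< (f≤g zero) (sumFin-mono-< (f≤g ∘ suc) a fa<ga)

sumFin-≥ : ∀ {k} (f : Fin k → ℕ) a → f a ≤ sumFin f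
sumFin-≥ f zero    = m≤m+n _ _
sumFin-≥ f (suc a) = ≤-trans (sumFin-≥ (f ∘ suc) a) (m≤n+m _ (f zero))

sumFin-const : ∀ k c → sumFin {k} (λ _ → c) ≡ k * c
sumFin-const zero    c = refl
sumFin-const (suc k) c = cong (c +_) (sumFin-const k c)

sumFin-+ : ∀ {k} (f g : Fin k → ℕ) → sumFin (λ i → f i + g i) ≡ sumFin f + sumFin g
sumFin-+ {zero}  f g = refl
sumFin-+ {suc k} f g =
  trans (cong (f zero + g zero +_) (sumFin-+ (f ∘ suc) (g ∘ suc))) (+-interchange (f zero) (g zero) _ _)

sumFin-*ˡ : ∀ {k} c (f : Fin k → ℕ) → sumFin (λ i → c * f i) ≡ c * sumFin f
sumFin-*ˡ {zero}  c f = sym (*-zeroʳ c)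
sumFin-*ˡ {suc k} c f =
  trans (cong (c * f zero +_) (sumFin-*ˡ c (f ∘ suc))) (sym (*-distribˡ-+ c (f zero) _))

sumFin-product : ∀ {m k} (f : Fin m → ℕ) (g : Fin k → ℕ) →
  sumFin (λ a → sumFin (λ b → f a * g b)) ≡ sumFin f * sumFin g
sumFin-product {zero}  f g = refl
sumFin-product {suc m} f g =
  trans (cong₂ _+_ (sumFin-*ˡ (f zero) g) (sumFin-product (f ∘ suc) g))
        (sym (*-distribʳ-+ (sumFin g) (f zero) _))

sumFin-point : ∀ {k} (f : Fin k → ℕ) a → sumFin (λ i → if does (i ≟ a) then f i else 0) ≡ f a
sumFin-point {suc k} f zero    = trans (cong (f zero +_) (trans (sumFin-const k 0) (*-zeroʳ k))) (+-identityʳ _)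
sumFin-point {suc k} f (suc a) = sumFin-point (f ∘ suc) a

sumFin-↑ : ∀ m k (f : Fin (m + k) → ℕ) → sumFin f ≡ sumFin (λ i → f (i ↑ˡ k)) + sumFin (λ j → f (m ↑ʳ j))
sumFin-↑ zero    k f = refl
sumFin-↑ (suc m) k f = trans (cong (f zero +_) (sumFin-↑ m k (f ∘ suc))) (sym (+-assoc (f zero) _ _))

sumFin-combine : ∀ m k (f : Fin (m * k) → ℕ) → sumFin f ≡ sumFin {m} (λ a → sumFin {k} (λ b → f (combine a b)))
sumFin-combine zero    k f = refl
sumFin-combine (suc m) k f =
  trans (sumFin-↑ k (m * k) f) (cong (sumFin (λ b → f (b ↑ˡ m * k)) +_) (sumFin-combine m k (f ∘ (k ↑ʳ_))))

does⇒ : ∀ {A : Set} (a? : Dec A) → does a? ≡ true → A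
does⇒ (true because [a]) _ = invert [a]

∨-true : ∀ x y → x ∨ y ≡ true → x ≡ true ⊎ y ≡ true
∨-true true  y _   = inj₁ refl
∨-true false y y≡t = inj₂ y≡t

anyFin-intro : ∀ {k} (f : Fin k → Bool) a → f a ≡ true → anyFin f ≡ true
anyFin-intro f zero    fa≡t = cong (_∨ anyFin (f ∘ suc)) fa≡t
anyFin-intro f (suc a) fa≡t = trans (cong (f zero ∨_) (anyFin-intro (f ∘ suc) a fa≡t)) (∨-zeroʳ _)

anyFin-elim : ∀ {k} (f : Fin k → Bool) → anyFin f ≡ true → ∃[ a ] f a ≡ true
anyFin-elim {suc k} f any≡t with ∨-true (f zero) _ any≡t
... | inj₁ f0≡t = zero , f0≡t
... | inj₂ rest with anyFin-elim (f ∘ suc) rest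
...   | a , fa≡t = suc a , fa≡t

anyFin-cong : ∀ {k} {f g : Fin k → Bool} → (∀ i → f i ≡ g i) → anyFin f ≡ anyFin g
anyFin-cong {zero}  f≗g = refl
anyFin-cong {suc k} f≗g = cong₂ _∨_ (f≗g zero) (anyFin-cong (f≗g ∘ suc))

module _ (G : Graph) where

  reach-refl : ∀ u → reach G 0 u u ≡ true
  reach-refl u = dec-true (u ≟ u) refl

  reach-zero : ∀ u v → reach G 0 u v ≡ true → u ≡ v
  reach-zero u v = does⇒ (u ≟ v)

  reach-suc : ∀ k {u v} → reach G k u v ≡ true → reach G (suc k) u v ≡ true
  reach-suc k {u} {v} r = cong (_∨ anyFin (λ w → reach G k u w ∧ adj G w v)) r

  reach-step : ∀ k {u w v} → reach G k u w ≡ true → adj G w v ≡ true → reach G (suc k) u v ≡ true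
  reach-step k {u} {w} {v} r e =
    trans (cong (reach G k u v ∨_) (anyFin-intro (λ m → reach G k u m ∧ adj G m v) w (cong₂ _∧_ r e)))
          (∨-zeroʳ _)

  reach-suc-inv : ∀ k {u v} → reach G (suc k) u v ≡ true →
    reach G k u v ≡ true ⊎ ∃[ w ] (reach G k u w ≡ true × adj G w v ≡ true)
  reach-suc-inv k {u} {v} r with ∨-true (reach G k u v) _ r
  ... | inj₁ r′ = inj₁ r′
  ... | inj₂ any≡t with anyFin-elim (λ m → reach G k u m ∧ adj G m v) any≡t
  ...   | w , re = inj₂ (w , ∧-conicalˡ _ _ re , ∧-conicalʳ _ _ re)

  reach-mono : ∀ {k m u v} → k ≤ m → reach G k u v ≡ true → reach G m u v ≡ true
  reach-mono k≤m = go (≤⇒≤′ k≤m)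
    where
    go : ∀ {k m u v} → k ≤′ m → reach G k u v ≡ true → reach G m u v ≡ true
    go ≤′-refl                r = r
    go (≤′-step {n = m} k≤′m) r = reach-suc m (go k≤′m r)

  reach-trans : ∀ k l {x y z} → reach G k x y ≡ true → reach G l y z ≡ true → reach G (k + l) x z ≡ true
  reach-trans k zero {y = y} {z} r s with refl ← reach-zero y z s rewrite +-identityʳ k = r
  reach-trans k (suc l) r s rewrite +-suc k l with reach-suc-inv l s
  ... | inj₁ s′           = reach-suc (k + l) (reach-trans k l r s′)
  ... | inj₂ (w , s′ , e) = reach-step (k + l) (reach-trans k l r s′) e

  reach-potential : (φ : V G → ℕ) → (∀ i j → adj G i j ≡ true → φ j ≤ suc (φ i)) →
    ∀ k {x y} → reach G k x y ≡ true → φ y ≤ φ x + k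
  reach-potential φ φ-edge zero {x} {y} r with refl ← reach-zero x y r = m≤m+n _ 0
  reach-potential φ φ-edge (suc k) {x} {y} r with reach-suc-inv k r
  ... | inj₁ r′ = ≤-trans (reach-potential φ φ-edge k r′) (+-monoʳ-≤ (φ x) (n≤1+n k))
  ... | inj₂ (w , r′ , e) = begin
    φ y         ≤⟨ φ-edge w y e ⟩
    suc (φ w)   ≤⟨ s≤s (reach-potential φ φ-edge k r′) ⟩
    suc (φ x + k) ≡⟨ +-suc (φ x) k ⟨
    φ x + suc k ∎
    where open ≤-Reasoning

module _ (G H : Graph) where

  reach-map : (f : V G → V H) → (∀ a c → adj G a c ≡ true → adj H (f a) (f c) ≡ true) →
    ∀ k {a c} → reach G k a c ≡ true → reach H k (f a) (f c) ≡ true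
  reach-map f f-adj zero {a} {c} r with refl ← reach-zero G a c r = reach-refl H (f _)
  reach-map f f-adj (suc k) r with reach-suc-inv G k r
  ... | inj₁ r′           = reach-suc H k (reach-map f f-adj k r′)
  ... | inj₂ (w , r′ , e) = reach-step H k (reach-map f f-adj k r′) (f-adj w _ e)

module _ (G : Graph) where

  ballSize : ℕ → V G → ℕ
  ballSize k u = sumFin (λ w → if reach G k u w then 1 else 0)

  Stable : ℕ → V G → Set
  Stable k u = ∀ w → reach G (suc k) u w ≡ reach G k u w

  stable? : ∀ k u → Dec (Stable k u)
  stable? k u = all? (λ w → reach G (suc k) u w Bool.≟ reach G k u w)

  stable-suc : ∀ {k u} → Stable k u → Stable (suc k) u
  stable-suc {k} {u} st w =
    trans (cong (reach G (suc k) u w ∨_) (anyFin-cong (λ m → cong (_∧ adj G m w) (st m))))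
          (absorb (reach G k u w) _)
    where
    absorb : ∀ x y → (x ∨ y) ∨ y ≡ x ∨ y
    absorb x y = trans (Bool.∨-assoc x y y) (cong (x ∨_) (Bool.∨-idem y))

  ballSize-≤ : ∀ k u → ballSize k u ≤ n G
  ballSize-≤ k u = begin
    ballSize k u            ≤⟨ sumFin-mono-≤ (λ w → indicator≤1 (reach G k u w)) ⟩
    sumFin {n G} (λ _ → 1)  ≡⟨ sumFin-const (n G) 1 ⟩
    n G * 1                 ≡⟨ *-identityʳ (n G) ⟩
    n G                     ∎
    where
    open ≤-Reasoning
    indicator≤1 : ∀ b → (if b then 1 else 0) ≤ 1
    indicator≤1 true  = ≤-refl
    indicator≤1 false = z≤n

  ballSize-zero : ∀ u → 1 ≤ ballSize 0 u
  ballSize-zero u = ≤-trans (≤-reflexive (cong (λ b → if b then 1 else 0) (sym (reach-refl G u))))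
                            (sumFin-≥ (λ w → if reach G 0 u w then 1 else 0) u)

  ballSize-< : ∀ k u → ¬ Stable k u → ballSize k u < ballSize (suc k) u
  ballSize-< k u unstable
    with w , changed ← ¬∀⟶∃¬ (n G) _ (λ w → reach G (suc k) u w Bool.≟ reach G k u w) unstable =
    sumFin-mono-< (λ w → grows (reach G k u w) _ (reach-suc G k {u})) w
                  (strict (reach G k u w) _ (reach-suc G k {u}) changed)
    where
    grows : ∀ x y → (x ≡ true → y ≡ true) → (if x then 1 else 0) ≤ (if y then 1 else 0)
    grows false y x⇒y = z≤n
    grows true  y x⇒y rewrite x⇒y refl = ≤-refl
    strict : ∀ x y → (x ≡ true → y ≡ true) → ¬ y ≡ x → (if x then 1 else 0) < (if y then 1 else 0)
    strict true  y     x⇒y y≢x = contradiction (x⇒y refl) y≢x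
    strict false true  x⇒y y≢x = ≤-refl
    strict false false x⇒y y≢x = contradiction refl y≢x

  -- A ball that is not yet stable has grown at every previous radius.
  unstable⇒ballSize-≥ : ∀ k u → ¬ Stable k u → k + 2 ≤ ballSize (suc k) u
  unstable⇒ballSize-≥ zero    u unstable = <-≤-trans (s≤s (ballSize-zero u)) (ballSize-< 0 u unstable)
  unstable⇒ballSize-≥ (suc k) u unstable =
    <-≤-trans (s≤s (unstable⇒ballSize-≥ k u (unstable ∘ stable-suc {k} {u}))) (ballSize-< (suc k) u unstable)

  stable-≥ : ∀ {k} u → n G ≤ k → Stable k u
  stable-≥ {k} u n≤k with stable? k u
  ... | yes st      = st
  ... | no unstable = contradiction
    (≤-trans (unstable⇒ballSize-≥ k u unstable) (≤-trans (ballSize-≤ (suc k) u) n≤k)) (m+1+n≰m k)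

  reach-≤n : ∀ K {u v} → reach G K u v ≡ true → reach G (n G) u v ≡ true
  reach-≤n K r with K ≤? n G
  reach-≤n K       r | yes K≤n = reach-mono G K≤n r
  reach-≤n zero    r | no K≰n  = contradiction z≤n K≰n
  reach-≤n (suc K) {u} {v} r | no K≰n =
    reach-≤n K (trans (sym (stable-≥ u (≤-pred (≰⇒> K≰n)) v)) r)

  distAux-≤ : ∀ {u v k} f j → j ≤ k → reach G k u v ≡ true → distAux G u v f j ≤ k
  distAux-≤ zero j j≤k r = j≤k
  distAux-≤ {u} {v} (suc f) j j≤k r with reach G j u v in found
  ... | true  = j≤k
  ... | false = distAux-≤ f (suc j) (≤∧≢⇒< j≤k λ { refl → contradiction (trans (sym found) r) λ () }) r

  dist-≤ : ∀ k {u v} → reach G k u v ≡ true → dist G u v ≤ k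
  dist-≤ k = distAux-≤ (n G) 0 z≤n

  distAux-reach : ∀ {u v K} f j → K ≤ j + f → reach G K u v ≡ true → reach G (distAux G u v f j) u v ≡ true
  distAux-reach {K = K} zero j K≤j r = reach-mono G (subst (K ≤_) (+-identityʳ j) K≤j) r
  distAux-reach {u} {v} {K} (suc f) j K≤j+f r with reach G j u v in found
  ... | true  = found
  ... | false = distAux-reach f (suc j) (subst (K ≤_) (+-suc j f) K≤j+f) r

  -- dist only searches the radii up to n G, hence the detour through reach-≤n.
  dist-reach : ∀ K {u v} → reach G K u v ≡ true → reach G (dist G u v) u v ≡ true
  dist-reach K r = distAux-reach (n G) 0 ≤-refl (reach-≤n K r)

  dist-self : ∀ u → dist G u u ≡ 0
  dist-self u = n≤0⇒n≡0 (dist-≤ 0 (reach-refl G u))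

  dist-edge : ∀ K {x w v} → reach G K x w ≡ true → adj G w v ≡ true → dist G x v ≤ suc (dist G x w)
  dist-edge K {x} {w} r e = dist-≤ (suc (dist G x w)) (reach-step G (dist G x w) (dist-reach K r) e)

  module _ (adj-sym : ∀ u v → adj G u v ≡ adj G v u) where

    reach-sym : ∀ k {u v} → reach G k u v ≡ true → reach G k v u ≡ true
    reach-sym zero {u} {v} r with refl ← reach-zero G u v r = r
    reach-sym (suc k) {u} {v} r with reach-suc-inv G k r
    ... | inj₁ r′           = reach-suc G k (reach-sym k r′)
    ... | inj₂ (w , r′ , e) =
      reach-trans G 1 k (reach-step G 0 {v} (reach-refl G v) (trans (adj-sym v w) e)) (reach-sym k r′)

    dist-sym : ∀ K {u v} → reach G K u v ≡ true → dist G u v ≡ dist G v u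
    dist-sym K {u} {v} r = ≤-antisym
      (dist-≤ (dist G v u) (reach-sym (dist G v u) (dist-reach K (reach-sym K r))))
      (dist-≤ (dist G u v) (reach-sym (dist G u v) (dist-reach K r)))

module _ (G H : Graph) where

  □-adjacency : V G × V H → V G × V H → Bool
  □-adjacency (a , b) (c , d) = (does (a ≟ c) ∧ adj H b d) ∨ (does (b ≟ d) ∧ adj G a c)

  □-adj : ∀ i j → adj (G □ H) i j ≡ □-adjacency (remQuot {n G} (n H) i) (remQuot {n G} (n H) j)
  □-adj i j with remQuot {n G} (n H) i | remQuot {n G} (n H) j
  ... | a , b | c , d = refl

  □-adj-combine : ∀ a b c d → adj (G □ H) (combine a b) (combine c d) ≡ □-adjacency (a , b) (c , d)
  □-adj-combine a b c d = trans (□-adj _ _) (cong₂ □-adjacency (remQuot-combine a b) (remQuot-combine c d))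

  □-adjˡ : ∀ {a c} b → adj G a c ≡ true → adj (G □ H) (combine a b) (combine c b) ≡ true
  □-adjˡ {a} {c} b e = begin
    adj (G □ H) (combine a b) (combine c b)                ≡⟨ □-adj-combine a b c b ⟩
    (does (a ≟ c) ∧ adj H b b) ∨ (does (b ≟ b) ∧ adj G a c) ≡⟨ cong₂ (λ x y → (does (a ≟ c) ∧ adj H b b) ∨ (x ∧ y)) (dec-true (b ≟ b) refl) e ⟩
    (does (a ≟ c) ∧ adj H b b) ∨ true                      ≡⟨ ∨-zeroʳ _ ⟩
    true                                                    ∎
    where open ≡-Reasoning

  □-adjʳ : ∀ a {b d} → adj H b d ≡ true → adj (G □ H) (combine a b) (combine a d) ≡ true
  □-adjʳ a {b} {d} e = begin
    adj (G □ H) (combine a b) (combine a d)                ≡⟨ □-adj-combine a b a d ⟩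
    (does (a ≟ a) ∧ adj H b d) ∨ (does (b ≟ d) ∧ adj G a a) ≡⟨ cong₂ (λ x y → (x ∧ y) ∨ (does (b ≟ d) ∧ adj G a a)) (dec-true (a ≟ a) refl) e ⟩
    true                                                    ∎
    where open ≡-Reasoning

  □-adjacency⇒ : ∀ p q → □-adjacency p q ≡ true →
    (proj₁ p ≡ proj₁ q × adj H (proj₂ p) (proj₂ q) ≡ true) ⊎ (proj₂ p ≡ proj₂ q × adj G (proj₁ p) (proj₁ q) ≡ true)
  □-adjacency⇒ (a , b) (c , d) e with ∨-true _ _ e
  ... | inj₁ e′ = inj₁ (does⇒ (a ≟ c) (∧-conicalˡ _ _ e′) , ∧-conicalʳ _ _ e′)
  ... | inj₂ e′ = inj₂ (does⇒ (b ≟ d) (∧-conicalˡ _ _ e′) , ∧-conicalʳ _ _ e′)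

reach-dist : ∀ {G} → IsConnectedGraph G → ∀ u v → reach G (dist G u v) u v ≡ true
reach-dist {G} conn u v with K , r ← IsConnectedGraph.connected conn u v = dist-reach G K r

module _ {G H : Graph} (G-conn : IsConnectedGraph G) (H-conn : IsConnectedGraph H) where

  private
    fst□ : V (G □ H) → V G
    fst□ i = proj₁ (remQuot {n G} (n H) i)

    snd□ : V (G □ H) → V H
    snd□ i = proj₂ (remQuot {n G} (n H) i)

    dist-sum : V (G □ H) → V (G □ H) → ℕ
    dist-sum x y = dist G (fst□ x) (fst□ y) + dist H (snd□ x) (snd□ y)

  reach-□ : ∀ x y → reach (G □ H) (dist-sum x y) x y ≡ true
  reach-□ x y = subst₂ (λ s t → reach (G □ H) (dist-sum x y) s t ≡ true) (combine-remQuot {n G} (n H) x) (combine-remQuot {n G} (n H) y)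
    (reach-trans (G □ H) (dist G (fst□ x) (fst□ y)) (dist H (snd□ x) (snd□ y))
      (reach-map G (G □ H) (λ a → combine a (snd□ x)) (λ _ _ → □-adjˡ G H (snd□ x))
        (dist G (fst□ x) (fst□ y)) (reach-dist G-conn (fst□ x) (fst□ y)))
      (reach-map H (G □ H) (combine (fst□ y)) (λ _ _ → □-adjʳ G H (fst□ y))
        (dist H (snd□ x) (snd□ y)) (reach-dist H-conn (snd□ x) (snd□ y))))

  dist-sum-edge : ∀ x i j → adj (G □ H) i j ≡ true → dist-sum x j ≤ suc (dist-sum x i)
  dist-sum-edge x i j e with □-adjacency⇒ G H _ _ (trans (sym (□-adj G H i j)) e)
  ... | inj₁ (fst-i≡fst-j , eH) = begin
    dG (fst□ j) + dH (snd□ j)       ≡⟨ cong (λ a → dG a + dH (snd□ j)) fst-i≡fst-j ⟨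
    dG (fst□ i) + dH (snd□ j)       ≤⟨ +-monoʳ-≤ (dG (fst□ i)) (dist-edge H (dH (snd□ i)) (reach-dist H-conn (snd□ x) (snd□ i)) eH) ⟩
    dG (fst□ i) + suc (dH (snd□ i)) ≡⟨ +-suc _ _ ⟩
    suc (dist-sum x i)              ∎
    where
    open ≤-Reasoning
    dG = dist G (fst□ x)
    dH = dist H (snd□ x)
  ... | inj₂ (snd-i≡snd-j , eG) = begin
    dG (fst□ j) + dH (snd□ j)       ≡⟨ cong (λ b → dG (fst□ j) + dH b) snd-i≡snd-j ⟨
    dG (fst□ j) + dH (snd□ i)       ≤⟨ +-monoˡ-≤ (dH (snd□ i)) (dist-edge G (dG (fst□ i)) (reach-dist G-conn (fst□ x) (fst□ i)) eG) ⟩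
    suc (dist-sum x i)              ∎
    where
    open ≤-Reasoning
    dG = dist G (fst□ x)
    dH = dist H (snd□ x)

  dist-□ : ∀ x y → dist (G □ H) x y ≡ dist-sum x y
  dist-□ x y = ≤-antisym (dist-≤ (G □ H) (dist-sum x y) (reach-□ x y)) (begin
    dist-sum x y                       ≤⟨ reach-potential (G □ H) (dist-sum x) (dist-sum-edge x) _ (dist-reach (G □ H) (dist-sum x y) (reach-□ x y)) ⟩
    dist-sum x x + dist (G □ H) x y    ≡⟨ cong (_+ dist (G □ H) x y) (cong₂ _+_ (dist-self G (fst□ x)) (dist-self H (snd□ x))) ⟩
    dist (G □ H) x y                   ∎)
    where open ≤-Reasoning

  dist-□-combine : ∀ a b c d → dist (G □ H) (combine a b) (combine c d) ≡ dist G a c + dist H b d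
  dist-□-combine a b c d = trans (dist-□ (combine a b) (combine c d))
    (cong₂ (λ p q → dist G (proj₁ p) (proj₁ q) + dist H (proj₂ p) (proj₂ q)) (remQuot-combine a b) (remQuot-combine c d))

  sumFin-2^dist-□ : ∀ a b → sumFin (λ y → 2 ^ dist (G □ H) (combine a b) y) ≡
                    sumFin (λ c → 2 ^ dist G a c) * sumFin (λ d → 2 ^ dist H b d)
  sumFin-2^dist-□ a b = begin
    sumFin (λ y → 2 ^ dist (G □ H) (combine a b) y)
      ≡⟨ sumFin-combine (n G) (n H) _ ⟩
    sumFin {n G} (λ c → sumFin {n H} (λ d → 2 ^ dist (G □ H) (combine a b) (combine c d)))
      ≡⟨ sumFin-cong {n G} (λ c → sumFin-cong {n H} (λ d → 2^dist-□ c d)) ⟩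
    sumFin (λ c → sumFin (λ d → 2 ^ dist G a c * 2 ^ dist H b d))
      ≡⟨ sumFin-product (λ c → 2 ^ dist G a c) (λ d → 2 ^ dist H b d) ⟩
    sumFin (λ c → 2 ^ dist G a c) * sumFin (λ d → 2 ^ dist H b d) ∎
    where
    open ≡-Reasoning
    2^dist-□ : ∀ c d → 2 ^ dist (G □ H) (combine a b) (combine c d) ≡ 2 ^ dist G a c * 2 ^ dist H b d
    2^dist-□ c d = trans (cong (2 ^_) (dist-□-combine a b c d)) (^-distribˡ-+-* 2 (dist G a c) (dist H b d))

  □-reachable : ∀ x y → ∃[ k ] reach (G □ H) k x y ≡ true
  □-reachable x y = dist-sum x y , reach-□ x y

module _ (G : Graph) (x : V G) where

  value : V G → ℕ
  value w = 2 ^ dist G x w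

  weight : Distribution G → ℕ
  weight D = sumFin (λ w → D w * value w)

  move-value : ∀ D u v → 2 ≤ D u → ∀ w →
    move G D u v w * value w + (if does (w ≟ u) then 2 * value w else 0) ≤
    D w * value w + (if does (w ≟ v) then value w else 0)
  move-value D u v 2≤Du w with w ≟ u
  ... | yes refl = begin
    (D w ∸ 2) * value w + 2 * value w ≡⟨ *-distribʳ-+ (value w) (D w ∸ 2) 2 ⟨
    (D w ∸ 2 + 2) * value w           ≡⟨ cong (_* value w) (m∸n+n≡m 2≤Du) ⟩
    D w * value w                     ≤⟨ m≤m+n _ _ ⟩
    D w * value w + (if does (w ≟ v) then value w else 0) ∎
    where open ≤-Reasoning
  ... | no _ with w ≟ v
  ...   | yes refl = ≤-reflexive (trans (+-identityʳ _) (+-comm (value w) _))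
  ...   | no _     = ≤-refl

  covers⇒weight-≥ : ∀ {D} → Covers G D → sumFin value ≤ weight D
  covers⇒weight-≥ {D} covers =
    sumFin-mono-≤ (λ w → subst (_≤ D w * value w) (*-identityˡ (value w)) (*-monoˡ-≤ (value w) (covers w)))

  simple : ℕ → Distribution G
  simple N w = if does (w ≟ x) then N else 0

  size-simple : ∀ N → size G (simple N) ≡ N
  size-simple N = sumFin-point (λ _ → N) x

  weight-simple : ∀ N → weight (simple N) ≡ N
  weight-simple N = begin
    weight (simple N)                                    ≡⟨ sumFin-cong on-root ⟩
    sumFin (λ w → if does (w ≟ x) then N * value w else 0) ≡⟨ sumFin-point (λ w → N * value w) x ⟩
    N * 2 ^ dist G x x                                   ≡⟨ cong (λ d → N * 2 ^ d) (dist-self G x) ⟩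
    N * 1                                                ≡⟨ *-identityʳ N ⟩
    N                                                    ∎
    where
    open ≡-Reasoning
    on-root : ∀ w → simple N w * value w ≡ (if does (w ≟ x) then N * value w else 0)
    on-root w with does (w ≟ x)
    ... | true  = refl
    ... | false = refl

  module _ (reachable : ∀ w → ∃[ k ] reach G k x w ≡ true) where

    value-edge : ∀ {w v} → adj G w v ≡ true → value v ≤ 2 * value w
    value-edge {w} e with k , r ← reachable w = ^-monoʳ-≤ 2 (dist-edge G k r e)

    weight-move : ∀ D u v → adj G u v ≡ true → 2 ≤ D u → weight (move G D u v) ≤ weight D
    weight-move D u v e 2≤Du = +-cancelʳ-≤ (2 * value u) _ _ (begin
      weight (move G D u v) + 2 * value u
        ≡⟨ cong (weight (move G D u v) +_) (sumFin-point (λ w → 2 * value w) u) ⟨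
      weight (move G D u v) + sumFin (λ w → if does (w ≟ u) then 2 * value w else 0)
        ≡⟨ sumFin-+ (λ w → move G D u v w * value w) _ ⟨
      sumFin (λ w → move G D u v w * value w + (if does (w ≟ u) then 2 * value w else 0))
        ≤⟨ sumFin-mono-≤ (move-value D u v 2≤Du) ⟩
      sumFin (λ w → D w * value w + (if does (w ≟ v) then value w else 0))
        ≡⟨ sumFin-+ (λ w → D w * value w) _ ⟩
      weight D + sumFin (λ w → if does (w ≟ v) then value w else 0)
        ≡⟨ cong (weight D +_) (sumFin-point value v) ⟩
      weight D + value v
        ≤⟨ +-monoʳ-≤ (weight D) (value-edge e) ⟩
      weight D + 2 * value u ∎)
      where open ≤-Reasoning

    weight-steps : ∀ {D D′} → Star (PebblingStep G) D D′ → weight D′ ≤ weight D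
    weight-steps ε = ≤-refl
    weight-steps (step {D} u v e 2≤Du ◅ steps) = ≤-trans (weight-steps steps) (weight-move D u v e 2≤Du)

    cover-pebbling-number-≥ : ∀ {γ} → IsCoverPebblingNumber G γ → sumFin value ≤ γ
    cover-pebbling-number-≥ {γ} (solvable , _) with D , steps , covers ← solvable (simple γ) (size-simple γ) = begin
      sumFin value       ≤⟨ covers⇒weight-≥ covers ⟩
      weight D           ≤⟨ weight-steps steps ⟩
      weight (simple γ)  ≡⟨ weight-simple γ ⟩
      γ                  ∎
      where open ≤-Reasoning

cover-pebbling-number-unique : ∀ {G γ γ′} → IsCoverPebblingNumber G γ → IsCoverPebblingNumber G γ′ → γ ≡ γ′
cover-pebbling-number-unique {γ = γ} {γ′} (solvable , minimal) (solvable′ , minimal′) with <-cmp γ γ′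
... | tri≈ _ γ≡γ′ _ = γ≡γ′
... | tri< γ<γ′ _ _ with D , size≡γ , unsolvable ← minimal′ γ γ<γ′ = contradiction (solvable D size≡γ) unsolvable
... | tri> _ _ γ′<γ with D , size≡γ′ , unsolvable ← minimal γ′ γ′<γ = contradiction (solvable′ D size≡γ′) unsolvable

good⇒root : ∀ {G γ} → IsConnectedGraph G → Good G → IsCoverPebblingNumber G γ →
  ∃[ u ] sumFin (λ w → 2 ^ dist G u w) ≡ γ
good⇒root {G} {γ} conn (γ′ , γ′-cpn , u , γ′≡) γ-cpn = u , (begin
  sumFin (λ w → 2 ^ dist G u w)  ≡⟨ sumFin-cong (λ w → cong (2 ^_) (dist-sym-from-u w)) ⟩
  sumFin (λ w → 2 ^ dist G w u)  ≡⟨ γ′≡ ⟨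
  γ′                             ≡⟨ cover-pebbling-number-unique γ′-cpn γ-cpn ⟩
  γ                              ∎)
  where
  open ≡-Reasoning
  dist-sym-from-u : ∀ w → dist G u w ≡ dist G w u
  dist-sym-from-u w = dist-sym G (IsConnectedGraph.symmetric conn) (dist G u w) (reach-dist conn u w)

proposition4p1 : (G H : Graph) → IsConnectedGraph G → IsConnectedGraph H →
    Good G → Good H →
    (γG γH : ℕ) → IsCoverPebblingNumber G γG → IsCoverPebblingNumber H γH →
    (∃[ x ] sumFin (λ y → 2 ^ dist (G □ H) x y) ≡ γG * γH) ×
    (∀ γGH → IsCoverPebblingNumber (G □ H) γGH → γG * γH ≤ γGH)
proposition4p1 G H G-conn H-conn G-good H-good γG γH γG-cpn γH-cpn
  with u , sumG ← good⇒root G-conn G-good γG-cpn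
     | v , sumH ← good⇒root H-conn H-good γH-cpn =
  (root , sum≡γGγH) ,
  λ γ γ-cpn → subst (_≤ γ) sum≡γGγH (cover-pebbling-number-≥ (G □ H) root (□-reachable G-conn H-conn root) γ-cpn)
  where
  root : V (G □ H)
  root = combine u v
  sum≡γGγH : sumFin (λ y → 2 ^ dist (G □ H) root y) ≡ γG * γH
  sum≡γGγH = trans (sumFin-2^dist-□ G-conn H-conn u v) (cong₂ _*_ sumG sumH)
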